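{- There is a bound $B\in\mathbb{N}$ such that for every $\mathsf{U}^\mathsf{t}\subseteq\{\neg,\mathbf{F},\mathbf{G}\}$ and every CTL formula $\phi=\mathsf{Qt}\cdot\phi'$ in $\mathrm{CTL}(\mathsf{Prop},\mathsf{U}^\mathsf{t},\emptyset,\emptyset)$, where $\mathsf{Qt}$ is a finite sequence of unary CTL operators and $\phi'$ a CTL formula, there is a sequence $\mathsf{Qt}'$ of unary CTL operators such that $\phi''=\mathsf{Qt}'\cdot\phi'$ belongs to $\mathrm{CTL}(\mathsf{Prop},\mathsf{U}^\mathsf{t},\emptyset,\emptyset)$, $|\mathsf{Qt}'|\le B$, and $\phi\equiv\phi''$.
   Context: Kripke structure: finite states $Q$, initial states $I$, labelling $\pi:Q\to2^{\mathsf{Prop}}$, nonempty successor sets $\mathrm{Succ}(q)$. $\mathrm{CTL}(\mathsf{Prop},\mathsf{U}^\mathsf{t},\emptyset,\emptyset)$ is the set of formulas $\phi::=p\mid\neg\phi\mid\exists\circ\phi\mid\forall\circ\phi$ with $p\in\mathsf{Prop}$, $\circ\in\mathsf{U}^\mathsf{t}\setminus\{\neg\}$, where $\neg$ may be used only if $\neg\in\mathsf{U}^\mathsf{t}$ (no binary operators). A unary CTL operator is $\neg$ or $Q\circ$ with $Q\in\{\exists,\forall\}$, $\circ\in\{\mathbf{F},\mathbf{G}\}$; $\mathsf{Qt}\cdot\phi'$ denotes applying the operators of the sequence $\mathsf{Qt}$ (leftmost outermost) to $\phi'$, and $|\mathsf{Qt}|$ is its length. Semantics: $q\models\exists\circ\phi$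 (resp. $\forall\circ\phi$) iff some (resp. every) infinite $\mathrm{Succ}$-path $\rho$ from $q$ satisfies $\circ\phi$, with $\rho\models\mathbf{F}\phi$ iff some $\rho[i]\models\phi$ and $\rho\models\mathbf{G}\phi$ iff all $\rho[i]\models\phi$. $\phi\equiv\phi''$ means every Kripke structure satisfies $\phi$ iff it satisfies $\phi''$ (a structure satisfies a formula iff all its initial states do). -}

module Defs where

open import Data.Nat using (ℕ; zero; suc)
open import Data.Fin using (Fin)
open import Data.Bool using (Bool; true; false)
open import Data.List using (List; []; _∷_; foldr)
open import Data.Product using (Σ; _×_; _,_)
open import Relation.Nullary using (¬_)
open import Relation.Binary.PropositionalEquality using (_≡_)

record Kripke (Prop : Set) : Set₁ where
  field
    nStates  : ℕ
    Init     : Fin nStates → Set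
    label    : Fin nStates → Prop → Set
    Succ     : Fin nStates → Fin nStates → Set
    succ-ne  : (q : Fin nStates) → Σ (Fin nStates) (λ q' → Succ q q')

record Path {Prop : Set} (K : Kripke Prop) (q : Fin (Kripke.nStates K)) : Set where
  field
    at     : ℕ → Fin (Kripke.nStates K)
    start  : at zero ≡ q
    step   : (i : ℕ) → Kripke.Succ K (at i) (at (suc i))

data Temp : Set where
  𝐅 𝐆 : Temp

data PQ : Set where
  E A : PQ

data UOp : Set where
  neg  : UOp
  path : PQ → Temp → UOp

-- CTL formulas built from atoms with the unary operators
-- (binary operators are absent from the fragments considered).
data Form (Prop : Set) : Set where
  atom : Prop → Form Prop
  op   : UOp → Form Prop → Form Prop

-- Qt · φ' : apply the operators of Qt, leftmost outermost.
_·_ : {Prop : Set} → List UOp → Form Prop → Form Prop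
Qt · φ = foldr op φ Qt

data Sym : Set where
  s¬ sF sG : Sym

UnarySet : Set
UnarySet = Sym → Bool

tempSym : Temp → Sym
tempSym 𝐅 = sF
tempSym 𝐆 = sG

data InFrag {Prop : Set} (Ut : UnarySet) : Form Prop → Set where
  atomI : (p : Prop) → InFrag Ut (atom p)
  negI  : {φ : Form Prop} → Ut s¬ ≡ true → InFrag Ut φ → InFrag Ut (op neg φ)
  pathI : {φ : Form Prop} (Q : PQ) (t : Temp) → Ut (tempSym t) ≡ true →
          InFrag Ut φ → InFrag Ut (op (path Q t) φ)

Sat : {Prop : Set} (K : Kripke Prop) → Fin (Kripke.nStates K) → Form Prop → Set
Sat K q (atom p) = Kripke.label K q p
Sat K q (op neg φ) = ¬ Sat K q φ
Sat K q (op (path E 𝐅) φ) = Σ (Path K q) λ ρ → Σ ℕ λ i → Sat K (Path.at ρ i) φ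
Sat K q (op (path E 𝐆) φ) = Σ (Path K q) λ ρ → (i : ℕ) → Sat K (Path.at ρ i) φ
Sat K q (op (path A 𝐅) φ) = (ρ : Path K q) → Σ ℕ λ i → Sat K (Path.at ρ i) φ
Sat K q (op (path A 𝐆) φ) = (ρ : Path K q) → (i : ℕ) → Sat K (Path.at ρ i) φ

Models : {Prop : Set} → Kripke Prop → Form Prop → Set
Models K φ = (q : Fin (Kripke.nStates K)) → Kripke.Init K q → Sat K q φ

_≣_ : {Prop : Set} → Form Prop → Form Prop → Set₁
φ ≣ ψ = (K : Kripke _) → (Models K φ → Models K ψ) × (Models K ψ → Models K φ)

{-# OPTIONS --safe #-}
module Submission where

open import Defs
open import Level using (0ℓ)
open import Axiom.ExcludedMiddle using (ExcludedMiddle)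
open import Axiom.DoubleNegationElimination using (DoubleNegationElimination; em⇒dne)
open import Data.Bool using (Bool; true; false; not)
open import Data.Empty using (⊥-elim)
open import Data.Fin using (Fin)
open import Data.List using (List; []; _∷_; [_]; _++_; length; map; foldr; concatMap; take; drop)
open import Data.List.Properties using (length-++; foldr-++; length-take; take++drop≡id)
open import Data.List.Membership.Propositional using (_∈_)
open import Data.List.Relation.Unary.All as All using (All; []; _∷_; all?)
open import Data.List.Relation.Unary.All.Properties using (map⁺)
open import Data.List.Relation.Unary.Any as Any using (Any; any?; here; there; satisfied)
open import Data.List.Relation.Binary.Pointwise using (Pointwise-≡⇒≡)
open import Data.List.Relation.Binary.Infix.Heterogeneous using (Infix; MkView; toView; _ⁱ++_)
open import Data.List.Relation.Binary.Infix.Heterogeneous.Properties using (infix?)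
open import Data.List.Relation.Binary.Sublist.Propositional
  using (⊆-refl; ⊆-trans) renaming (_⊆_ to _⊑_)
open import Data.List.Relation.Binary.Sublist.Propositional.Properties using (++⁺; All-resp-⊆)
open import Data.Nat using (ℕ; zero; suc; _+_; _*_; _≤_; _<_; _≤?_; _<?_; s≤s; z≤n)
open import Data.Nat.Induction using (<-wellFounded)
open import Data.Nat.Properties
  using (≤-refl; ≤-trans; +-mono-≤; +-monoˡ-≤; +-monoˡ-<; *-monoˡ-≤; ≰⇒>; m≤n⇒m⊓n≡m; module ≤-Reasoning)
open import Data.Product using (Σ; Σ-syntax; ∃-syntax; _×_; _,_; proj₁; proj₂)
open import Data.Product.Properties using (≡-dec)
open import Data.Sum using (_⊎_; inj₁; inj₂)
open import Function using (_∘_; _on_)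
open import Induction.WellFounded using (Acc; acc)
open import Relation.Binary.Construct.On as On using ()
open import Relation.Binary.Definitions using (DecidableEquality)
open import Relation.Binary.PropositionalEquality using (_≡_; refl; sym; trans; cong; subst; subst₂)
open import Relation.Nullary using (¬_; Dec; yes; no; contradiction)
open import Relation.Nullary.Decidable using (True; toWitness; from-yes; map′; _×-dec_)
open import Relation.Unary using (Pred; Decidable; U; _⊆′_; _≐′_; ∁)
open import Relation.Unary.Properties using (⊆′-refl; ⊆′-trans; ≐′-refl; ≐′-sym; ≐′-trans)

-- Pushing negations inwards with the dualities ¬ EF = AG ¬ and ¬ AF = EG ¬ turns Qt · φ' into
-- v · φ' or v · ¬ φ' for a word v over EF, AF, EG and AG.  On the predicates of a Kripke structure
-- EF and AF are closure operators and EG and AG interior operators, with AF ≤ EF and AG ≤ EG, so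
-- two adjacent operators of the same temporal kind collapse into one.  Together with the fixpoint
-- laws EG Q = Q when every Q-state has a Q-successor and AG Q = Q when Q is closed under successors
-- this yields twenty laws, each deleting letters, and every word of length 6 contains the left-hand
-- side of one of them; so v reduces to an equivalent subword of length at most 5.  A letter whose
-- temporal operator is missing from U^t can only have arisen by dualisation, so ¬ ∈ U^t and it is
-- written back as ¬ (dual letter) ¬; this gives at most 3 · 5 + 1 = 16 operators.

-- Closure and interior operators on predicates

PredOp : Set → Set₁
PredOp S = Pred S 0ℓ → Pred S 0ℓ

module _ {S : Set} where

  infix 4 _≃_

  _≃_ : PredOp S → PredOp S → Set₁
  f ≃ g = ∀ P → f P ≐′ g P

  ≃-trans : {f g h : PredOp S} → f ≃ g → g ≃ h → f ≃ h
  ≃-trans f≃g g≃h P = ≐′-trans (f≃g P) (g≃h P)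

  Monotone : PredOp S → Set₁
  Monotone f = ∀ {P Q} → P ⊆′ Q → f P ⊆′ f Q

  mono⇒cong : {f : PredOp S} → Monotone f → ∀ {P Q} → P ≐′ Q → f P ≐′ f Q
  mono⇒cong mono (P⊆Q , Q⊆P) = mono P⊆Q , mono Q⊆P

  record IsClosure (f : PredOp S) : Set₁ where
    field
      monotone     : Monotone f
      inflationary : ∀ P → P ⊆′ f P
      idempotent   : ∀ P → f (f P) ⊆′ f P

  record IsInterior (f : PredOp S) : Set₁ where
    field
      monotone     : Monotone f
      deflationary : ∀ P → f P ⊆′ P
      idempotent   : ∀ P → f P ⊆′ f (f P)

  module _ {f g : PredOp S} (f≤g : ∀ P → f P ⊆′ g P) where

    closure-absorbˡ : IsClosure f → IsClosure g → f ∘ g ≃ g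
    closure-absorbˡ f-cl g-cl P =
      ⊆′-trans (f≤g (g P)) (IsClosure.idempotent g-cl P) , IsClosure.inflationary f-cl (g P)

    closure-absorbʳ : IsClosure f → IsClosure g → g ∘ f ≃ g
    closure-absorbʳ f-cl g-cl P =
      ⊆′-trans (monotone (f≤g P)) (idempotent P) , monotone (IsClosure.inflationary f-cl P)
      where open IsClosure g-cl

    interior-absorbˡ : IsInterior f → IsInterior g → f ∘ g ≃ f
    interior-absorbˡ f-int g-int P =
      monotone (IsInterior.deflationary g-int P) , ⊆′-trans (idempotent P) (monotone (f≤g P))
      where open IsInterior f-int

    interior-absorbʳ : IsInterior f → IsInterior g → g ∘ f ≃ f
    interior-absorbʳ f-int g-int P =
      IsInterior.deflationary g-int (f P) ,
      ⊆′-trans (IsInterior.idempotent f-int P) (f≤g (f P))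

  module _ {c i : PredOp S} (c-cl : IsClosure c) (i-int : IsInterior i) where
    open IsClosure c-cl renaming (monotone to c-mono)
    open IsInterior i-int renaming (monotone to i-mono; idempotent to i-idem)

    closure-interior-absorb : c ∘ i ∘ c ∘ i ≃ c ∘ i
    closure-interior-absorb P =
      ⊆′-trans (c-mono (deflationary (c (i P)))) (idempotent (i P)) ,
      ⊆′-trans (c-mono (i-idem P)) (c-mono (i-mono (inflationary (i P))))

    interior-closure-absorb : i ∘ c ∘ i ∘ c ≃ i ∘ c
    interior-closure-absorb P =
      i-mono (⊆′-trans (c-mono (deflationary (c P))) (idempotent P)) ,
      ⊆′-trans (i-idem (c P)) (i-mono (inflationary (i (c P))))

  ∁-anti : {P Q : Pred S 0ℓ} → P ⊆′ Q → ∁ Q ⊆′ ∁ P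
  ∁-anti P⊆Q x ¬q p = ¬q (P⊆Q x p)

  ∁-cong : {P Q : Pred S 0ℓ} → P ≐′ Q → ∁ P ≐′ ∁ Q
  ∁-cong (P⊆Q , Q⊆P) = ∁-anti Q⊆P , ∁-anti P⊆Q

  complementIf : Bool → Pred S 0ℓ → Pred S 0ℓ
  complementIf false P = P
  complementIf true  P = ∁ P

  module _ (dne : DoubleNegationElimination 0ℓ) where

    ∁∁ : (P : Pred S 0ℓ) → ∁ (∁ P) ≐′ P
    ∁∁ P = (λ _ → dne) , λ _ p ¬p → ¬p p

    ∁-complementIf : ∀ b (P : Pred S 0ℓ) → ∁ (complementIf b P) ≐′ complementIf (not b) P
    ∁-complementIf false P = ≐′-refl
    ∁-complementIf true  P = ∁∁ P

    dual-sym : {f g : PredOp S} → Monotone g → ∁ ∘ f ≃ g ∘ ∁ → ∁ ∘ g ≃ f ∘ ∁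
    dual-sym g-mono ∁f≃g∁ P =
      ≐′-trans (∁-cong (≐′-sym (≐′-trans (∁f≃g∁ (∁ P)) (mono⇒cong g-mono (∁∁ P)))))
               (∁∁ _)

PathOp : Set
PathOp = PQ × Temp

pattern EF = E , 𝐅
pattern AF = A , 𝐅
pattern EG = E , 𝐆
pattern AG = A , 𝐆

dualPQ : PQ → PQ
dualPQ E = A
dualPQ A = E

dualTemp : Temp → Temp
dualTemp 𝐅 = 𝐆
dualTemp 𝐆 = 𝐅

dualTemp-involutive : ∀ t → dualTemp (dualTemp t) ≡ t
dualTemp-involutive 𝐅 = refl
dualTemp-involutive 𝐆 = refl

dual : PathOp → PathOp
dual (Q , t) = dualPQ Q , dualTemp t

dual-involutive : ∀ X → dual (dual X) ≡ X
dual-involutive EF = refl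
dual-involutive AF = refl
dual-involutive EG = refl
dual-involutive AG = refl

_≟PQ_ : DecidableEquality PQ
E ≟PQ E = yes refl
E ≟PQ A = no λ ()
A ≟PQ E = no λ ()
A ≟PQ A = yes refl

_≟Temp_ : DecidableEquality Temp
𝐅 ≟Temp 𝐅 = yes refl
𝐅 ≟Temp 𝐆 = no λ ()
𝐆 ≟Temp 𝐅 = no λ ()
𝐆 ≟Temp 𝐆 = yes refl

_≟_ : DecidableEquality PathOp
_≟_ = ≡-dec _≟PQ_ _≟Temp_

open import Data.List.Relation.Binary.Sublist.DecPropositional _≟_
  using () renaming (_⊆?_ to _⊑?_)

pathOps : List PathOp
pathOps = EF ∷ AF ∷ EG ∷ AG ∷ []

∈-pathOps : ∀ X → X ∈ pathOps
∈-pathOps EF = here refl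
∈-pathOps AF = there (here refl)
∈-pathOps EG = there (there (here refl))
∈-pathOps AG = there (there (there (here refl)))

∀-PathOp? : ∀ {p} {P : Pred PathOp p} → Decidable P → Dec (∀ X → P X)
∀-PathOp? P? =
  map′ (λ all X → All.lookup all (∈-pathOps X)) (λ h → All.tabulate λ {X} _ → h X)
       (all? P? pathOps)

every-word? : ∀ {p} n {P : Pred (List PathOp) p} → Decidable P →
              Dec (∀ w → length w ≡ n → P w)
every-word? zero P? =
  map′ (λ { p [] refl → p ; p (_ ∷ _) () }) (λ h → h [] refl) (P? [])
every-word? (suc n) P? =
  map′ (λ { h [] () ; h (X ∷ w) refl → h X w refl }) (λ h X w → h (X ∷ w) ∘ cong suc)
       (∀-PathOp? λ X → every-word? n (P? ∘ (X ∷_)))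

length-infix-< : {L : Set} (pre suf : List L) {l r : List L} →
                 length r < length l → length (pre ++ r ++ suf) < length (pre ++ l ++ suf)
length-infix-< [] suf {l} {r} r<l rewrite length-++ r {suf} | length-++ l {suf} =
  +-monoˡ-< (length suf) r<l
length-infix-< (_ ∷ pre) suf r<l = s≤s (length-infix-< pre suf r<l)

length-concatMap-≤ : {L M : Set} {f : L → List M} {k : ℕ} →
                     (∀ x → length (f x) ≤ k) → ∀ xs → length (concatMap f xs) ≤ length xs * k
length-concatMap-≤ f≤k [] = z≤n
length-concatMap-≤ {f = f} {k} f≤k (x ∷ xs) = begin
  length (f x ++ concatMap f xs)          ≡⟨ length-++ (f x) ⟩
  length (f x) + length (concatMap f xs)  ≤⟨ +-mono-≤ (f≤k x) (length-concatMap-≤ f≤k xs) ⟩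
  length (x ∷ xs) * k                     ∎
  where open ≤-Reasoning

-- Pushing negations inwards, and writing path operators back into a fragment

pathWord : List UOp → List PathOp
pathWord []               = []
pathWord (neg ∷ Qt)       = map dual (pathWord Qt)
pathWord (path Q t ∷ Qt)  = (Q , t) ∷ pathWord Qt

negParity : List UOp → Bool
negParity []              = false
negParity (neg ∷ Qt)      = not (negParity Qt)
negParity (path _ _ ∷ Qt) = negParity Qt

expand : UnarySet → PathOp → List UOp
expand Ut (Q , t) with Ut (tempSym t)
... | true  = [ path Q t ]
... | false = neg ∷ path (dualPQ Q) (dualTemp t) ∷ neg ∷ []

negIf : Bool → List UOp
negIf false = []
negIf true  = [ neg ]

realise : UnarySet → List PathOp → Bool → List UOp
realise Ut v b = concatMap (expand Ut) v ++ negIf b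

·-++ : {Prop : Set} (Qt Qt′ : List UOp) (φ : Form Prop) → (Qt ++ Qt′) · φ ≡ Qt · (Qt′ · φ)
·-++ Qt Qt′ φ = foldr-++ op φ Qt Qt′

-- Either the letter itself or ¬ (dual letter) ¬ lies in the fragment.
Expressible : UnarySet → PathOp → Set
Expressible Ut (_ , t) = Ut (tempSym t) ≡ true ⊎ Ut s¬ ≡ true × Ut (tempSym (dualTemp t)) ≡ true

module _ {Prop : Set} {Ut : UnarySet} where

  InFrag-inner : ∀ Qt {φ : Form Prop} → InFrag Ut (Qt · φ) → InFrag Ut φ
  InFrag-inner []              φ∈               = φ∈
  InFrag-inner (neg ∷ Qt)      (negI _ φ∈)      = InFrag-inner Qt φ∈
  InFrag-inner (path _ _ ∷ Qt) (pathI _ _ _ φ∈) = InFrag-inner Qt φ∈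

  Expressible-dual : Ut s¬ ≡ true → ∀ X → Expressible Ut X → Expressible Ut (dual X)
  Expressible-dual ¬∈ (_ , t) (inj₁ t∈) =
    inj₂ (¬∈ , subst (λ t′ → Ut (tempSym t′) ≡ true) (sym (dualTemp-involutive t)) t∈)
  Expressible-dual ¬∈ _ (inj₂ (_ , t̄∈)) = inj₁ t̄∈

  pathWord-expressible : ∀ Qt {φ : Form Prop} → InFrag Ut (Qt · φ) →
                         All (Expressible Ut) (pathWord Qt)
  pathWord-expressible []                φ∈                 = []
  pathWord-expressible (neg ∷ Qt)        (negI ¬∈ φ∈)       =
    map⁺ (All.map (λ {X} → Expressible-dual ¬∈ X) (pathWord-expressible Qt φ∈))
  pathWord-expressible (path Q t ∷ Qt)   (pathI _ _ t∈ φ∈)  = inj₁ t∈ ∷ pathWord-expressible Qt φ∈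

  negParity-InFrag : ∀ Qt {φ : Form Prop} → InFrag Ut (Qt · φ) →
                     negParity Qt ≡ true → Ut s¬ ≡ true
  negParity-InFrag []              φ∈               ()
  negParity-InFrag (neg ∷ Qt)      (negI ¬∈ _)      _ = ¬∈
  negParity-InFrag (path _ _ ∷ Qt) (pathI _ _ _ φ∈)   = negParity-InFrag Qt φ∈

  expand-InFrag : ∀ X {ψ : Form Prop} → Expressible Ut X → InFrag Ut ψ →
                  InFrag Ut (expand Ut X · ψ)
  expand-InFrag (Q , t) e ψ∈ with Ut (tempSym t) in t∈?
  expand-InFrag (Q , t) e ψ∈                 | true  = pathI Q t t∈? ψ∈
  expand-InFrag (Q , t) (inj₁ ()) ψ∈         | false
  expand-InFrag (Q , t) (inj₂ (¬∈ , t̄∈)) ψ∈ | false =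
    negI ¬∈ (pathI (dualPQ Q) (dualTemp t) t̄∈ (negI ¬∈ ψ∈))

  realise-InFrag : ∀ v b {φ : Form Prop} → All (Expressible Ut) v → (b ≡ true → Ut s¬ ≡ true) →
                   InFrag Ut φ → InFrag Ut (realise Ut v b · φ)
  realise-InFrag v b {φ} es b⇒¬∈ φ∈ =
    subst (InFrag Ut) (sym (·-++ (concatMap (expand Ut) v) (negIf b) φ))
          (expandAll es (negIf-InFrag b b⇒¬∈))
    where
      negIf-InFrag : ∀ b → (b ≡ true → Ut s¬ ≡ true) → InFrag Ut (negIf b · φ)
      negIf-InFrag false _     = φ∈
      negIf-InFrag true  b⇒¬∈ = negI (b⇒¬∈ refl) φ∈

      expandAll : ∀ {v} {ψ : Form Prop} → All (Expressible Ut) v → InFrag Ut ψ →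
                  InFrag Ut (concatMap (expand Ut) v · ψ)
      expandAll []                 ψ∈ = ψ∈
      expandAll {X ∷ v} {ψ} (e ∷ es) ψ∈ =
        subst (InFrag Ut) (sym (·-++ (expand Ut X) (concatMap (expand Ut) v) ψ))
              (expand-InFrag X e (expandAll es ψ∈))

realise-length : ∀ Ut v b → length (realise Ut v b) ≤ length v * 3 + 1
realise-length Ut v b = begin
  length (concatMap (expand Ut) v ++ negIf b)
    ≡⟨ length-++ (concatMap (expand Ut) v) ⟩
  length (concatMap (expand Ut) v) + length (negIf b)
    ≤⟨ +-mono-≤ (length-concatMap-≤ expand≤3 v) (negIf≤1 b) ⟩
  length v * 3 + 1
    ∎
  where
    open ≤-Reasoning
    expand≤3 : ∀ X → length (expand Ut X) ≤ 3
    expand≤3 (Q , t) with Ut (tempSym t)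
    ... | true  = s≤s z≤n
    ... | false = ≤-refl
    negIf≤1 : ∀ b → length (negIf b) ≤ 1
    negIf≤1 false = z≤n
    negIf≤1 true  = ≤-refl

-- Path operators on the predicates of a Kripke structure

module Semantics (lem : ExcludedMiddle 0ℓ) {Prop : Set} (K : Kripke Prop) where
  open Kripke K
  open Path

  State : Set
  State = Fin nStates

  dne : DoubleNegationElimination 0ℓ
  dne = em⇒dne lem

  ⟦_⟧ : PathOp → PredOp State
  ⟦ EF ⟧ P s = Σ[ ρ ∈ Path K s ] Σ[ i ∈ ℕ ] P (at ρ i)
  ⟦ EG ⟧ P s = Σ[ ρ ∈ Path K s ] ∀ i → P (at ρ i)
  ⟦ AF ⟧ P s = (ρ : Path K s) → Σ[ i ∈ ℕ ] P (at ρ i)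
  ⟦ AG ⟧ P s = (ρ : Path K s) → ∀ i → P (at ρ i)

  ⟦_⟧* : List PathOp → PredOp State
  ⟦ v ⟧* P = foldr ⟦_⟧ P v

  ‖_‖ : Form Prop → Pred State 0ℓ
  ‖ φ ‖ s = Sat K s φ

  tail : ∀ {s} (ρ : Path K s) → Path K (at ρ 1)
  tail ρ = record { at = at ρ ∘ suc ; start = refl ; step = step ρ ∘ suc }

  first-step : ∀ {s} (ρ : Path K s) → Succ s (at ρ 1)
  first-step ρ = subst (λ s → Succ s (at ρ 1)) (start ρ) (step ρ 0)

  infixr 5 _◅_

  _◅_ : ∀ {s t} → Succ s t → Path K t → Path K s
  _◅_ {s} s→t ρ = record
    { at    = λ { zero → s ; (suc i) → at ρ i }
    ; start = refl
    ; step  = λ { zero → subst (Succ s) (sym (start ρ)) s→t ; (suc i) → step ρ i }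
    }

  suffix : ∀ {s} (ρ : Path K s) i → Path K (at ρ i)
  suffix ρ i = record { at = λ j → at ρ (j + i) ; start = refl ; step = λ j → step ρ (j + i) }

  EX : PredOp State
  EX P s = ∃[ t ] Succ s t × P t

  Invariant : Pred State 0ℓ → Set
  Invariant P = ∀ {s t} → Succ s t → P s → P t

  invariant⇒EX : ∀ {P} → Invariant P → P ⊆′ EX P
  invariant⇒EX inv s p = let (t , s→t) = succ-ne s in t , s→t , inv s→t p

  EG-coinduction : ∀ I → I ⊆′ EX I → I ⊆′ ⟦ EG ⟧ I
  EG-coinduction I next s i₀ = ρ , proj₂ ∘ walk
    where
      walk : ℕ → Σ State I
      walk zero    = s , i₀
      walk (suc n) = let (t , _ , it) = next _ (proj₂ (walk n)) in t , it

      ρ : Path K s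
      ρ = record
        { at    = proj₁ ∘ walk
        ; start = refl
        ; step  = λ n → proj₁ (proj₂ (next _ (proj₂ (walk n))))
        }

  AG-induction : ∀ I → Invariant I → I ⊆′ ⟦ AG ⟧ I
  AG-induction I inv s i₀ ρ = along
    where
      along : ∀ n → I (at ρ n)
      along zero    = subst I (sym (start ρ)) i₀
      along (suc n) = inv (step ρ n) (along n)

  somePath : ∀ s → Path K s
  somePath s = proj₁ (EG-coinduction U (invariant⇒EX _) s _)

  ⟦⟧-monotone : ∀ X → Monotone ⟦ X ⟧
  ⟦⟧-monotone EF P⊆Q s (ρ , i , p) = ρ , i , P⊆Q _ p
  ⟦⟧-monotone EG P⊆Q s (ρ , h)     = ρ , λ i → P⊆Q _ (h i)
  ⟦⟧-monotone AF P⊆Q s h ρ         = let (i , p) = h ρ in i , P⊆Q _ p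
  ⟦⟧-monotone AG P⊆Q s h ρ i       = P⊆Q _ (h ρ i)

  ⟦⟧-cong : ∀ X {P Q} → P ≐′ Q → ⟦ X ⟧ P ≐′ ⟦ X ⟧ Q
  ⟦⟧-cong X = mono⇒cong (⟦⟧-monotone X)

  ⟦⟧*-cong : ∀ v {P Q} → P ≐′ Q → ⟦ v ⟧* P ≐′ ⟦ v ⟧* Q
  ⟦⟧*-cong []      P≐Q = P≐Q
  ⟦⟧*-cong (X ∷ v) P≐Q = ⟦⟧-cong X (⟦⟧*-cong v P≐Q)

  ⟦⟧*-context : ∀ {l r} pre suf → ⟦ l ⟧* ≃ ⟦ r ⟧* →
                ⟦ pre ++ l ++ suf ⟧* ≃ ⟦ pre ++ r ++ suf ⟧*
  ⟦⟧*-context {l} {r} [] suf l≃r P =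
    subst₂ _≐′_ (sym (foldr-++ ⟦_⟧ P l suf)) (sym (foldr-++ ⟦_⟧ P r suf)) (l≃r (⟦ suf ⟧* P))
  ⟦⟧*-context (X ∷ pre) suf l≃r P = ⟦⟧-cong X (⟦⟧*-context pre suf l≃r P)

  EF-backward : ∀ P {s t} → Succ s t → ⟦ EF ⟧ P t → ⟦ EF ⟧ P s
  EF-backward P s→t (ρ , i , p) = s→t ◅ ρ , suc i , p

  EF-along : ∀ P {s} (ρ : Path K s) i → ⟦ EF ⟧ P (at ρ i) → ⟦ EF ⟧ P s
  EF-along P ρ zero    q = subst (⟦ EF ⟧ P) (start ρ) q
  EF-along P ρ (suc i) q = EF-backward P (first-step ρ) (EF-along P (tail ρ) i q)

  EG-EX : ∀ P → ⟦ EG ⟧ P ⊆′ EX (⟦ EG ⟧ P)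
  EG-EX P s (ρ , h) = at ρ 1 , first-step ρ , tail ρ , h ∘ suc

  AG-invariant : ∀ P → Invariant (⟦ AG ⟧ P)
  AG-invariant P s→t h ρ i = h (s→t ◅ ρ) (suc i)

  EF-closure : IsClosure ⟦ EF ⟧
  EF-closure = record
    { monotone     = ⟦⟧-monotone EF
    ; inflationary = λ P s p → somePath s , 0 , subst P (sym (start (somePath s))) p
    ; idempotent   = λ P s (ρ , i , q) → EF-along P ρ i q
    }

  AF-closure : IsClosure ⟦ AF ⟧
  AF-closure = record
    { monotone     = ⟦⟧-monotone AF
    ; inflationary = λ P s p ρ → 0 , subst P (sym (start ρ)) p
    ; idempotent   = λ P s h ρ → let (i , g) = h ρ ; (j , p) = g (suffix ρ i) in j + i , p
    }

  EG-interior : IsInterior ⟦ EG ⟧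
  EG-interior = record
    { monotone     = ⟦⟧-monotone EG
    ; deflationary = λ P s (ρ , h) → subst P (start ρ) (h 0)
    ; idempotent   = λ P → EG-coinduction (⟦ EG ⟧ P) (EG-EX P)
    }

  AG-interior : IsInterior ⟦ AG ⟧
  AG-interior = record
    { monotone     = ⟦⟧-monotone AG
    ; deflationary = λ P s h → subst P (start (somePath s)) (h (somePath s) 0)
    ; idempotent   = λ P → AG-induction (⟦ AG ⟧ P) (AG-invariant P)
    }

  AF⊆EF : ∀ P → ⟦ AF ⟧ P ⊆′ ⟦ EF ⟧ P
  AF⊆EF P s h = somePath s , h (somePath s)

  AG⊆EG : ∀ P → ⟦ AG ⟧ P ⊆′ ⟦ EG ⟧ P
  AG⊆EG P s h = somePath s , h (somePath s)

  open IsClosure AF-closure using () renaming (inflationary to AF-inflationary)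
  open IsClosure EF-closure using () renaming (inflationary to EF-inflationary)
  open IsInterior EG-interior using () renaming (deflationary to EG-deflationary)
  open IsInterior AG-interior using () renaming (deflationary to AG-deflationary)

  AF-step : ∀ P {s t} → ¬ P s → ⟦ AF ⟧ P s → Succ s t → ⟦ AF ⟧ P t
  AF-step P ¬p h s→t ρ with h (s→t ◅ ρ)
  ... | zero  , p = ⊥-elim (¬p p)
  ... | suc i , p = i , p

  AF-back : ∀ P {s} → (∀ {t} → Succ s t → ⟦ AF ⟧ P t) → ⟦ AF ⟧ P s
  AF-back P next ρ = let (i , p) = next (first-step ρ) (tail ρ) in suc i , p

  AF-unfold : ∀ P {s} → ⟦ AF ⟧ P s → P s ⊎ (∀ {t} → Succ s t → ⟦ AF ⟧ P t)
  AF-unfold P {s} h with lem {P s}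
  ... | yes p = inj₁ p
  ... | no ¬p = inj₂ (AF-step P ¬p h)

  AF-EX : ∀ Q → Q ⊆′ EX Q → ⟦ AF ⟧ Q ⊆′ EX (⟦ AF ⟧ Q)
  AF-EX Q next s h with AF-unfold Q h
  ... | inj₁ q    = let (t , s→t , q′) = next s q in t , s→t , AF-inflationary Q t q′
  ... | inj₂ next′ = let (t , s→t) = succ-ne s in t , s→t , next′ s→t

  EF-EX : ∀ Q → Q ⊆′ EX Q → ⟦ EF ⟧ Q ⊆′ EX (⟦ EF ⟧ Q)
  EF-EX Q next s (ρ , zero , q) =
    let (t , s→t , q′) = next s (subst Q (start ρ) q) in t , s→t , EF-inflationary Q t q′
  EF-EX Q next s (ρ , suc i , q) = at ρ 1 , first-step ρ , tail ρ , i , q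

  AF-invariant : ∀ Q → Invariant Q → Invariant (⟦ AF ⟧ Q)
  AF-invariant Q inv s→t h with AF-unfold Q h
  ... | inj₁ q     = AF-inflationary Q _ (inv s→t q)
  ... | inj₂ next  = next s→t

  EG-fix : ∀ Q → Q ⊆′ EX Q → ⟦ EG ⟧ Q ≐′ Q
  EG-fix Q next = EG-deflationary Q , EG-coinduction Q next

  AG-fix : ∀ Q → Invariant Q → ⟦ AG ⟧ Q ≐′ Q
  AG-fix Q inv = AG-deflationary Q , AG-induction Q inv

  AF∘EG-absorb : ∀ R → ⟦ AF ⟧ R ⊆′ R → ⟦ AF ⟧ (⟦ EG ⟧ R) ≐′ ⟦ EG ⟧ R
  AF∘EG-absorb R AF-R⊆R =
    ⊆′-trans (EG-coinduction (⟦ AF ⟧ (⟦ EG ⟧ R)) (AF-EX (⟦ EG ⟧ R) (EG-EX R)))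
             (⟦⟧-monotone EG (⊆′-trans (⟦⟧-monotone AF (EG-deflationary R)) AF-R⊆R)) ,
    AF-inflationary (⟦ EG ⟧ R)

  AF∘AG-absorb : ∀ R → ⟦ AF ⟧ R ⊆′ R → ⟦ AF ⟧ (⟦ AG ⟧ R) ≐′ ⟦ AG ⟧ R
  AF∘AG-absorb R AF-R⊆R =
    ⊆′-trans (AG-induction (⟦ AF ⟧ (⟦ AG ⟧ R)) (AF-invariant (⟦ AG ⟧ R) (AG-invariant R)))
             (⟦⟧-monotone AG (⊆′-trans (⟦⟧-monotone AF (AG-deflationary R)) AF-R⊆R)) ,
    AF-inflationary (⟦ AG ⟧ R)

  EF∘EG-absorb : ∀ R → ⟦ EF ⟧ R ⊆′ R → ⟦ EF ⟧ (⟦ EG ⟧ R) ≐′ ⟦ EG ⟧ R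
  EF∘EG-absorb R EF-R⊆R =
    ⊆′-trans (EG-coinduction (⟦ EF ⟧ (⟦ EG ⟧ R)) (EF-EX (⟦ EG ⟧ R) (EG-EX R)))
             (⟦⟧-monotone EG (⊆′-trans (⟦⟧-monotone EF (EG-deflationary R)) EF-R⊆R)) ,
    EF-inflationary (⟦ EG ⟧ R)

  AG∘EG≃AG : ⟦ AG ⟧ ∘ ⟦ EG ⟧ ≃ ⟦ AG ⟧
  AG∘EG≃AG = interior-absorbˡ AG⊆EG AG-interior EG-interior

  EG∘AG≃AG : ⟦ EG ⟧ ∘ ⟦ AG ⟧ ≃ ⟦ AG ⟧
  EG∘AG≃AG = interior-absorbʳ AG⊆EG AG-interior EG-interior

  AG∘AG≃AG : ⟦ AG ⟧ ∘ ⟦ AG ⟧ ≃ ⟦ AG ⟧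
  AG∘AG≃AG = interior-absorbˡ (λ _ → ⊆′-refl) AG-interior AG-interior

  EG∘EG≃EG : ⟦ EG ⟧ ∘ ⟦ EG ⟧ ≃ ⟦ EG ⟧
  EG∘EG≃EG = interior-absorbˡ (λ _ → ⊆′-refl) EG-interior EG-interior

  AF∘EF≃EF : ⟦ AF ⟧ ∘ ⟦ EF ⟧ ≃ ⟦ EF ⟧
  AF∘EF≃EF = closure-absorbˡ AF⊆EF AF-closure EF-closure

  EF∘AF≃EF : ⟦ EF ⟧ ∘ ⟦ AF ⟧ ≃ ⟦ EF ⟧
  EF∘AF≃EF = closure-absorbʳ AF⊆EF AF-closure EF-closure

  AF∘AF≃AF : ⟦ AF ⟧ ∘ ⟦ AF ⟧ ≃ ⟦ AF ⟧
  AF∘AF≃AF = closure-absorbˡ (λ _ → ⊆′-refl) AF-closure AF-closure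

  EF∘EF≃EF : ⟦ EF ⟧ ∘ ⟦ EF ⟧ ≃ ⟦ EF ⟧
  EF∘EF≃EF = closure-absorbˡ (λ _ → ⊆′-refl) EF-closure EF-closure

  EG∘AF∘EG≃AF∘EG : ⟦ EG ⟧ ∘ ⟦ AF ⟧ ∘ ⟦ EG ⟧ ≃ ⟦ AF ⟧ ∘ ⟦ EG ⟧
  EG∘AF∘EG≃AF∘EG P = EG-fix _ (AF-EX _ (EG-EX P))

  EG∘AF∘AG≃AF∘AG : ⟦ EG ⟧ ∘ ⟦ AF ⟧ ∘ ⟦ AG ⟧ ≃ ⟦ AF ⟧ ∘ ⟦ AG ⟧
  EG∘AF∘AG≃AF∘AG P = EG-fix _ (AF-EX _ (invariant⇒EX (AG-invariant P)))

  AG∘AF∘AG≃AF∘AG : ⟦ AG ⟧ ∘ ⟦ AF ⟧ ∘ ⟦ AG ⟧ ≃ ⟦ AF ⟧ ∘ ⟦ AG ⟧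
  AG∘AF∘AG≃AF∘AG P = AG-fix _ (AF-invariant _ (AG-invariant P))

  EG∘EF∘EG≃EF∘EG : ⟦ EG ⟧ ∘ ⟦ EF ⟧ ∘ ⟦ EG ⟧ ≃ ⟦ EF ⟧ ∘ ⟦ EG ⟧
  EG∘EF∘EG≃EF∘EG P = EG-fix _ (EF-EX _ (EG-EX P))

  EG∘EF∘AG≃EF∘AG : ⟦ EG ⟧ ∘ ⟦ EF ⟧ ∘ ⟦ AG ⟧ ≃ ⟦ EF ⟧ ∘ ⟦ AG ⟧
  EG∘EF∘AG≃EF∘AG P = EG-fix _ (EF-EX _ (invariant⇒EX (AG-invariant P)))

  AF∘EG∘EF≃EG∘EF : ⟦ AF ⟧ ∘ ⟦ EG ⟧ ∘ ⟦ EF ⟧ ≃ ⟦ EG ⟧ ∘ ⟦ EF ⟧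
  AF∘EG∘EF≃EG∘EF P = AF∘EG-absorb (⟦ EF ⟧ P) (proj₁ (AF∘EF≃EF P))

  AF∘EG∘AF≃EG∘AF : ⟦ AF ⟧ ∘ ⟦ EG ⟧ ∘ ⟦ AF ⟧ ≃ ⟦ EG ⟧ ∘ ⟦ AF ⟧
  AF∘EG∘AF≃EG∘AF P = AF∘EG-absorb (⟦ AF ⟧ P) (proj₁ (AF∘AF≃AF P))

  AF∘AG∘EF≃AG∘EF : ⟦ AF ⟧ ∘ ⟦ AG ⟧ ∘ ⟦ EF ⟧ ≃ ⟦ AG ⟧ ∘ ⟦ EF ⟧
  AF∘AG∘EF≃AG∘EF P = AF∘AG-absorb (⟦ EF ⟧ P) (proj₁ (AF∘EF≃EF P))

  AF∘AG∘AF≃AG∘AF : ⟦ AF ⟧ ∘ ⟦ AG ⟧ ∘ ⟦ AF ⟧ ≃ ⟦ AG ⟧ ∘ ⟦ AF ⟧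
  AF∘AG∘AF≃AG∘AF P = AF∘AG-absorb (⟦ AF ⟧ P) (proj₁ (AF∘AF≃AF P))

  EF∘EG∘EF≃EG∘EF : ⟦ EF ⟧ ∘ ⟦ EG ⟧ ∘ ⟦ EF ⟧ ≃ ⟦ EG ⟧ ∘ ⟦ EF ⟧
  EF∘EG∘EF≃EG∘EF P = EF∘EG-absorb (⟦ EF ⟧ P) (proj₁ (EF∘EF≃EF P))

  EF∘AG∘EF∘AG≃EF∘AG : ⟦ EF ⟧ ∘ ⟦ AG ⟧ ∘ ⟦ EF ⟧ ∘ ⟦ AG ⟧ ≃ ⟦ EF ⟧ ∘ ⟦ AG ⟧
  EF∘AG∘EF∘AG≃EF∘AG = closure-interior-absorb EF-closure AG-interior

  AG∘EF∘AG∘EF≃AG∘EF : ⟦ AG ⟧ ∘ ⟦ EF ⟧ ∘ ⟦ AG ⟧ ∘ ⟦ EF ⟧ ≃ ⟦ AG ⟧ ∘ ⟦ EF ⟧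
  AG∘EF∘AG∘EF≃AG∘EF = interior-closure-absorb EF-closure AG-interior

  ∁-EF : ∁ ∘ ⟦ EF ⟧ ≃ ⟦ AG ⟧ ∘ ∁
  ∁-EF P = (λ s ¬ef ρ i p → ¬ef (ρ , i , p)) , (λ s ag (ρ , i , p) → ag ρ i p)

  ∁-AF : ∁ ∘ ⟦ AF ⟧ ≃ ⟦ EG ⟧ ∘ ∁
  ∁-AF P =
    ⊆′-trans (EG-coinduction (∁ (⟦ AF ⟧ P)) escape)
             (⟦⟧-monotone EG (∁-anti (AF-inflationary P))) ,
    λ s (ρ , h) af → let (i , p) = af ρ in h i p
    where
      escape : ∁ (⟦ AF ⟧ P) ⊆′ EX (∁ (⟦ AF ⟧ P))
      escape s ¬af =
        dne λ stuck → ¬af (AF-back P λ {t} s→t → dne λ ¬af-t → stuck (t , s→t , ¬af-t))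

  ∁-⟦_⟧ : ∀ X → ∁ ∘ ⟦ X ⟧ ≃ ⟦ dual X ⟧ ∘ ∁
  ∁-⟦ EF ⟧ = ∁-EF
  ∁-⟦ AF ⟧ = ∁-AF
  ∁-⟦ EG ⟧ = dual-sym dne (⟦⟧-monotone EG) ∁-AF
  ∁-⟦ AG ⟧ = dual-sym dne (⟦⟧-monotone AG) ∁-EF

  ∁-⟦_⟧* : ∀ v → ∁ ∘ ⟦ v ⟧* ≃ ⟦ map dual v ⟧* ∘ ∁
  ∁-⟦ [] ⟧*    P = ≐′-refl
  ∁-⟦ X ∷ v ⟧* P = ≐′-trans (∁-⟦ X ⟧ (⟦ v ⟧* P)) (⟦⟧-cong (dual X) (∁-⟦ v ⟧* P))

  ∁∘⟦dual⟧∘∁ : ∀ X → ∁ ∘ ⟦ dual X ⟧ ∘ ∁ ≃ ⟦ X ⟧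
  ∁∘⟦dual⟧∘∁ X P =
    ≐′-trans (∁-⟦ dual X ⟧ (∁ P))
             (subst (λ Y → ⟦ Y ⟧ (∁ (∁ P)) ≐′ ⟦ X ⟧ P) (sym (dual-involutive X))
                    (⟦⟧-cong X (∁∁ dne P)))

  ‖path‖ : ∀ Q t φ → ‖ op (path Q t) φ ‖ ≐′ ⟦ Q , t ⟧ ‖ φ ‖
  ‖path‖ E 𝐅 φ = ≐′-refl
  ‖path‖ E 𝐆 φ = ≐′-refl
  ‖path‖ A 𝐅 φ = ≐′-refl
  ‖path‖ A 𝐆 φ = ≐′-refl

  ‖‖-≡ : ∀ {φ ψ} → φ ≡ ψ → ‖ φ ‖ ≐′ ‖ ψ ‖
  ‖‖-≡ refl = ≐′-refl

  pathWord-sound : ∀ Qt φ → ‖ Qt · φ ‖ ≐′ ⟦ pathWord Qt ⟧* (complementIf (negParity Qt) ‖ φ ‖)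
  pathWord-sound []              φ = ≐′-refl
  pathWord-sound (neg ∷ Qt)      φ =
    ≐′-trans (∁-cong (pathWord-sound Qt φ))
      (≐′-trans (∁-⟦ pathWord Qt ⟧* _)
                (⟦⟧*-cong (map dual (pathWord Qt)) (∁-complementIf dne (negParity Qt) ‖ φ ‖)))
  pathWord-sound (path Q t ∷ Qt) φ =
    ≐′-trans (‖path‖ Q t (Qt · φ)) (⟦⟧-cong (Q , t) (pathWord-sound Qt φ))

  expand-sound : ∀ Ut X ψ → ‖ expand Ut X · ψ ‖ ≐′ ⟦ X ⟧ ‖ ψ ‖
  expand-sound Ut (Q , t) ψ with Ut (tempSym t)
  ... | true  = ‖path‖ Q t ψ
  ... | false =
    ≐′-trans (∁-cong (‖path‖ (dualPQ Q) (dualTemp t) (op neg ψ))) (∁∘⟦dual⟧∘∁ (Q , t) ‖ ψ ‖)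

  realise-sound : ∀ Ut v b φ → ‖ realise Ut v b · φ ‖ ≐′ ⟦ v ⟧* (complementIf b ‖ φ ‖)
  realise-sound Ut v b φ =
    ≐′-trans (‖‖-≡ (·-++ (concatMap (expand Ut) v) (negIf b) φ))
             (≐′-trans (expandAll-sound v (negIf b · φ)) (⟦⟧*-cong v (negIf-sound b)))
    where
      negIf-sound : ∀ b → ‖ negIf b · φ ‖ ≐′ complementIf b ‖ φ ‖
      negIf-sound false = ≐′-refl
      negIf-sound true  = ≐′-refl

      expandAll-sound : ∀ v ψ → ‖ concatMap (expand Ut) v · ψ ‖ ≐′ ⟦ v ⟧* ‖ ψ ‖
      expandAll-sound []      ψ = ≐′-refl
      expandAll-sound (X ∷ v) ψ =
        ≐′-trans (‖‖-≡ (·-++ (expand Ut X) (concatMap (expand Ut) v) ψ))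
          (≐′-trans (expand-sound Ut X _) (⟦⟧-cong X (expandAll-sound v ψ)))

-- Deleting letters by the laws

module Rewriting (lem : ExcludedMiddle 0ℓ) where
  open Semantics lem
    using ( ⟦⟧*-context
          ; AG∘EG≃AG; EG∘AG≃AG; AG∘AG≃AG; EG∘EG≃EG; AF∘EF≃EF; EF∘AF≃EF; AF∘AF≃AF; EF∘EF≃EF
          ; EG∘AF∘EG≃AF∘EG; EG∘AF∘AG≃AF∘AG; AG∘AF∘AG≃AF∘AG; EG∘EF∘EG≃EF∘EG; EG∘EF∘AG≃EF∘AG
          ; AF∘EG∘EF≃EG∘EF; AF∘EG∘AF≃EG∘AF; AF∘AG∘EF≃AG∘EF; AF∘AG∘AF≃AG∘AF; EF∘EG∘EF≃EG∘EF
          ; EF∘AG∘EF∘AG≃EF∘AG; AG∘EF∘AG∘EF≃AG∘EF )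

  infix 4 _≈_ _⟶_

  _≈_ : List PathOp → List PathOp → Set₁
  u ≈ v = ∀ {Prop} (K : Kripke Prop) → let open Semantics lem K in ⟦ u ⟧* ≃ ⟦ v ⟧*

  record _⟶_ (w w′ : List PathOp) : Set₁ where
    field
      sound   : w ≈ w′
      sublist : w′ ⊑ w
      shorter : length w′ < length w

  open _⟶_

  ⟶-context : ∀ {l r} pre suf → l ⟶ r → pre ++ l ++ suf ⟶ pre ++ r ++ suf
  ⟶-context pre suf l⟶r = record
    { sound   = λ K → ⟦⟧*-context K pre suf (sound l⟶r K)
    ; sublist = ++⁺ (⊆-refl {x = pre}) (++⁺ (sublist l⟶r) (⊆-refl {x = suf}))
    ; shorter = length-infix-< pre suf (shorter l⟶r)
    }

  record Rule : Set₁ where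
    field
      {lhs rhs} : List PathOp
      rewrites  : lhs ⟶ rhs

  -- The side conditions r ⊑ l and |r| < |l| are discharged by evaluation where a rule is written.
  rule : ∀ l r → l ≈ r → {True (r ⊑? l ×-dec length r <? length l)} → Rule
  rule l r l≈r {checked} = record
    { rewrites = record
      { sound   = l≈r
      ; sublist = proj₁ (toWitness checked)
      ; shorter = proj₂ (toWitness checked)
      }
    }

  rules : List Rule
  rules =
    rule (AG ∷ EG ∷ [])           (AG ∷ [])       AG∘EG≃AG ∷
    rule (EG ∷ AG ∷ [])           (AG ∷ [])       EG∘AG≃AG ∷
    rule (AG ∷ AG ∷ [])           (AG ∷ [])       AG∘AG≃AG ∷
    rule (EG ∷ EG ∷ [])           (EG ∷ [])       EG∘EG≃EG ∷
    rule (AF ∷ EF ∷ [])           (EF ∷ [])       AF∘EF≃EF ∷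
    rule (EF ∷ AF ∷ [])           (EF ∷ [])       EF∘AF≃EF ∷
    rule (AF ∷ AF ∷ [])           (AF ∷ [])       AF∘AF≃AF ∷
    rule (EF ∷ EF ∷ [])           (EF ∷ [])       EF∘EF≃EF ∷
    rule (EG ∷ AF ∷ EG ∷ [])      (AF ∷ EG ∷ [])  EG∘AF∘EG≃AF∘EG ∷
    rule (EG ∷ AF ∷ AG ∷ [])      (AF ∷ AG ∷ [])  EG∘AF∘AG≃AF∘AG ∷
    rule (AG ∷ AF ∷ AG ∷ [])      (AF ∷ AG ∷ [])  AG∘AF∘AG≃AF∘AG ∷
    rule (EG ∷ EF ∷ EG ∷ [])      (EF ∷ EG ∷ [])  EG∘EF∘EG≃EF∘EG ∷
    rule (EG ∷ EF ∷ AG ∷ [])      (EF ∷ AG ∷ [])  EG∘EF∘AG≃EF∘AG ∷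
    rule (AF ∷ EG ∷ EF ∷ [])      (EG ∷ EF ∷ [])  AF∘EG∘EF≃EG∘EF ∷
    rule (AF ∷ EG ∷ AF ∷ [])      (EG ∷ AF ∷ [])  AF∘EG∘AF≃EG∘AF ∷
    rule (AF ∷ AG ∷ EF ∷ [])      (AG ∷ EF ∷ [])  AF∘AG∘EF≃AG∘EF ∷
    rule (AF ∷ AG ∷ AF ∷ [])      (AG ∷ AF ∷ [])  AF∘AG∘AF≃AG∘AF ∷
    rule (EF ∷ EG ∷ EF ∷ [])      (EG ∷ EF ∷ [])  EF∘EG∘EF≃EG∘EF ∷
    rule (EF ∷ AG ∷ EF ∷ AG ∷ []) (EF ∷ AG ∷ [])  EF∘AG∘EF∘AG≃EF∘AG ∷
    rule (AG ∷ EF ∷ AG ∷ EF ∷ []) (AG ∷ EF ∷ [])  AG∘EF∘AG∘EF≃AG∘EF ∷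
    []

  Reducible : Pred (List PathOp) _
  Reducible w = Any (λ ρ → Infix _≡_ (Rule.lhs ρ) w) rules

  reducible? : Decidable Reducible
  reducible? w = any? (λ ρ → infix? _≟_ (Rule.lhs ρ) w) rules

  reduce : ∀ {w} → Reducible w → ∃[ w′ ] w ⟶ w′
  reduce red with satisfied red
  ... | ρ , lhs-infix with toView lhs-infix
  ...   | MkView pre lhs≋ suf with Pointwise-≡⇒≡ lhs≋
  ...     | refl = _ , ⟶-context pre suf (Rule.rewrites ρ)

  -- Decided by evaluation on all 4⁶ words.
  length-6-reducible : ∀ w → length w ≡ 6 → Reducible w
  length-6-reducible = from-yes (every-word? 6 reducible?)

  irreducible⇒length≤5 : ∀ w → ¬ Reducible w → length w ≤ 5
  irreducible⇒length≤5 w irr with length w ≤? 5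
  ... | yes w≤5 = w≤5
  ... | no  w≰5 =
    contradiction (subst Reducible (take++drop≡id 6 w) (Any.map (_ⁱ++ drop 6 w) prefix)) irr
    where
      prefix : Reducible (take 6 w)
      prefix = length-6-reducible (take 6 w) (trans (length-take 6 w) (m≤n⇒m⊓n≡m (≰⇒> w≰5)))

  record Normalised (w : List PathOp) : Set₁ where
    field
      word       : List PathOp
      equivalent : w ≈ word
      word⊑w     : word ⊑ w
      bounded    : length word ≤ 5

  normalise : ∀ w → Normalised w
  normalise w = go w (On.wellFounded length <-wellFounded w)
    where
      go : ∀ w → Acc (_<_ on length) w → Normalised w
      go w (acc rec) with reducible? w
      ... | no irr = record
        { word       = w
        ; equivalent = λ K P → ≐′-refl
        ; word⊑w     = ⊆-refl
        ; bounded    = irreducible⇒length≤5 w irr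
        }
      ... | yes red with (w′ , w⟶w′) ← reduce red = record
        { word       = word
        ; equivalent = λ K → ≃-trans (sound w⟶w′ K) (equivalent K)
        ; word⊑w     = ⊆-trans word⊑w (sublist w⟶w′)
        ; bounded    = bounded
        }
        where open Normalised (go w′ (rec (shorter w⟶w′)))

≐⇒≣ : {Prop : Set} (φ ψ : Form Prop) →
      (∀ K → (λ q → Sat K q φ) ≐′ (λ q → Sat K q ψ)) → φ ≣ ψ
≐⇒≣ φ ψ φ≐ψ K =
  (λ ⊨φ q i → proj₁ (φ≐ψ K) q (⊨φ q i)) , (λ ⊨ψ q i → proj₂ (φ≐ψ K) q (⊨ψ q i))

short-equivalent-prefix :
  ExcludedMiddle 0ℓ → {Prop : Set} (Ut : UnarySet) (Qt : List UOp) (φ : Form Prop) →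
  InFrag Ut (Qt · φ) →
  Σ[ Qt′ ∈ List UOp ] InFrag Ut (Qt′ · φ) × length Qt′ ≤ 16 × (Qt · φ) ≣ (Qt′ · φ)
short-equivalent-prefix lem Ut Qt φ φ∈ = realise Ut word b , in-fragment , short ,
  ≐⇒≣ (Qt · φ) (realise Ut word b · φ) equivalent′
  where
    open Rewriting lem
    open Normalised (normalise (pathWord Qt))

    b : Bool
    b = negParity Qt

    in-fragment : InFrag Ut (realise Ut word b · φ)
    in-fragment = realise-InFrag word b (All-resp-⊆ word⊑w (pathWord-expressible Qt φ∈))
                                 (negParity-InFrag Qt φ∈) (InFrag-inner Qt φ∈)

    short : length (realise Ut word b) ≤ 16
    short = ≤-trans (realise-length Ut word b) (+-monoˡ-≤ 1 (*-monoˡ-≤ 3 bounded))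

    equivalent′ : ∀ K → (λ q → Sat K q (Qt · φ)) ≐′ (λ q → Sat K q (realise Ut word b · φ))
    equivalent′ K =
      ≐′-trans (pathWord-sound Qt φ)
               (≐′-trans (equivalent K _) (≐′-sym (realise-sound Ut word b φ)))
      where open Semantics lem K

lemma30 : ExcludedMiddle 0ℓ → (Prop : Set) →
    Σ ℕ λ B → (Ut : UnarySet) (Qt : List UOp) (φ' : Form Prop) →
    InFrag Ut (Qt · φ') →
    Σ (List UOp) λ Qt' → InFrag Ut (Qt' · φ') × length Qt' ≤ B × ((Qt · φ') ≣ (Qt' · φ'))
lemma30 lem Prop = 16 , short-equivalent-prefix lem
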